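{- Let $k\ge 3$ and $1\le \ell\le k-1$ be integers and let $P$ be a $k$-uniform $\ell$-path with $n$ vertices. Let $w_1 = k-1$ and $w_2=\dots=w_k=\lfloor\frac{k}{k-\ell}\rfloor(k-\ell) - 1$, and set $W = \sum_{i \in [k]} w_i$. Then $V(P)$ may be partitioned into sets $U_1, \dots, U_k$ so that (a) for each $i \in [k]$, every edge of $P$ has precisely one vertex in $U_i$, and (b) for each $i \in [k]$ we have $|U_i| = \frac{w_i}{W}n \pm 2$.
   Context: A $k$-uniform $\ell$-path is a $k$-uniform hypergraph with no isolated vertices whose vertices are linearly ordered so that every edge consists of $k$ consecutive vertices and any two consecutive edges intersect in exactly $\ell$ vertices. The notation $a = b\pm c$ means $b-c\le a\le b+c$. $[k]=\{1,\dots,k\}$. -}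

module Defs where

open import Data.Nat using (ℕ; zero; suc; _+_; _*_; _∸_; _≤_; _<_)
open import Data.Nat.DivMod using (_/_)
open import Data.Nat.Properties using (<-trans; n<1+n)
open import Data.Fin using (Fin; toℕ; fromℕ<)
open import Data.Fin.Subset using (Subset; _∈_; _∩_; ∣_∣)
open import Data.Product using (Σ; ∃; _×_)
open import Function.Bundles using (_⇔_)
open import Function.Definitions using (Injective)
open import Relation.Binary.PropositionalEquality using (_≡_)

ΣFin : (n : ℕ) → (Fin n → ℕ) → ℕ
ΣFin zero    f = 0
ΣFin (suc n) f = f Fin.zero + ΣFin n (λ i → f (Fin.suc i))

-- A hypergraph on the vertex set Fin n (vertices linearly ordered by the
-- natural order of Fin n) with m edges, given as an injective family of
-- subsets (edges are distinct) listed in path order.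
IsConsecutive : (k n : ℕ) → Subset n → Set
IsConsecutive k n e =
  Σ ℕ λ s → (s + k ≤ n) × ((v : Fin n) → (v ∈ e) ⇔ ((s ≤ toℕ v) × (toℕ v < s + k)))

record IsLPath (k ℓ n m : ℕ) (E : Fin m → Subset n) : Set where
  field
    distinct     : Injective _≡_ _≡_ E
    consecutive  : (j : Fin m) → IsConsecutive k n (E j)
    overlapℓ     : (j : ℕ) (p : suc j < m) → ∣ E (fromℕ< (<-trans (n<1+n j) p)) ∩ E (fromℕ< p) ∣ ≡ ℓ
    noIsolated   : (v : Fin n) → ∃ λ j → v ∈ E j

-- ⌊ k / d ⌋ * d - 1, with junk value 0 when d = 0 (never used: d = k - ℓ ≥ 1).
wRest : ℕ → ℕ → ℕ
wRest k zero    = 0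
wRest k (suc d) = (k / suc d) * suc d ∸ 1

-- Weights w_1 … w_k, indexed by Fin k (index zero is w_1).
w : (k ℓ : ℕ) → Fin k → ℕ
w k ℓ Fin.zero    = k ∸ 1
w k ℓ (Fin.suc _) = wRest k (k ∸ ℓ)

Wsum : (k ℓ : ℕ) → ℕ
Wsum k ℓ = ΣFin k (w k ℓ)

module Submission where

-- Put d = k − ℓ and P = ⌊k/d⌋·d, so that k = P + r with r < d.  Consecutive edges of an
-- ℓ-path start exactly d apart and some edge starts at vertex 0, so every edge is an interval
-- of k vertices starting at a multiple of d.  Mark the vertices congruent to d − 1 modulo P:
-- such an interval contains exactly one marked vertex, since its last r vertices have residues
-- 0, …, r − 1 modulo d.  So U₁ = {marked vertices} meets every edge once, and the remaining
-- k − 1 vertices of an edge are consecutive among the unmarked ones; colouring the unmarked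
-- vertices by their rank modulo k − 1 gives U₂, …, U_k.  Counting residues in a prefix gives
-- |U₁| = n/P ± 1 and |U_i| = (n − |U₁|)/(k − 1) ± 1, which is (b) because W = (k − 1)P.

open import Defs
open import Data.Bool using (Bool; true; false; not; _∧_)
open import Data.Bool.Properties using (∧-identityʳ; ∧-zeroʳ; T-≡; T-∧; ¬-not)
open import Data.Nat
open import Data.Nat.Properties
open import Data.Nat.DivMod
open import Data.Nat.Divisibility using (_∣_; ∣⇒≤; ∣m∣n⇒∣m+n; m%n≡0⇒n∣m; n∣m*n)
open import Data.Product using (Σ; ∃; _×_; _,_; proj₁; proj₂)
open import Data.Sum using (_⊎_; inj₁; inj₂)
open import Data.Fin as Fin using (Fin; toℕ)
open import Data.Fin.Properties using (toℕ-fromℕ<; toℕ-injective; toℕ<n; fromℕ<-toℕ; fromℕ<-cong)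
open import Data.Fin.Subset using (Subset; _∈_; _∩_; ∣_∣; inside; outside)
open import Data.Fin.Subset.Properties using (x∈p∩q⁺; x∈p∩q⁻; ∩-comm)
open import Data.Vec using (_∷_; []; tabulate; here; there)
open import Data.Vec.Properties using ([]=⇒lookup; lookup⇒[]=; lookup∘tabulate)
open import Relation.Nullary using (contradiction)
open import Function using (_∘_)
open import Algebra.Properties.CommutativeSemigroup +-commutativeSemigroup
  using () renaming (interchange to +-interchange)
open import Function.Bundles using (_⇔_; mk⇔; Equivalence)
open import Function.Properties.Equivalence using () renaming (sym to ⇔-sym; trans to ⇔-trans)
open import Relation.Binary.PropositionalEquality

bit : Bool → ℕ
bit false = 0
bit true  = 1

count : (ℕ → Bool) → ℕ → ℕ
count f zero    = 0
count f (suc n) = bit (f 0) + count (f ∘ suc) n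

count-cong : ∀ {f g} n → (∀ x → x < n → f x ≡ g x) → count f n ≡ count g n
count-cong zero    _  = refl
count-cong (suc n) eq = cong₂ _+_ (cong bit (eq 0 z<s)) (count-cong n (λ x x<n → eq (suc x) (s<s x<n)))

count-+ : ∀ f a L → count f (a + L) ≡ count f a + count (λ x → f (a + x)) L
count-+ f zero    L = refl
count-+ f (suc a) L = trans (cong (bit (f 0) +_) (count-+ (f ∘ suc) a L)) (sym (+-assoc (bit (f 0)) _ _))

count-none : ∀ {f} n → (∀ x → x < n → f x ≡ false) → count f n ≡ 0
count-none zero    _ = refl
count-none (suc n) h rewrite h 0 z<s = count-none n (λ x x<n → h (suc x) (s<s x<n))

count-all : ∀ {f} n → (∀ x → x < n → f x ≡ true) → count f n ≡ n
count-all zero    _ = refl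
count-all (suc n) h rewrite h 0 z<s = cong suc (count-all n (λ x x<n → h (suc x) (s<s x<n)))

count-suc : ∀ f n → count f (suc n) ≡ count f n + bit (f n)
count-suc f n = begin
  count f (suc n)                     ≡⟨ cong (count f) (+-comm 1 n) ⟩
  count f (n + 1)                     ≡⟨ count-+ f n 1 ⟩
  count f n + (bit (f (n + 0)) + 0)   ≡⟨ cong (λ y → count f n + (bit (f y) + 0)) (+-identityʳ n) ⟩
  count f n + (bit (f n) + 0)         ≡⟨ cong (count f n +_) (+-identityʳ _) ⟩
  count f n + bit (f n)               ∎
  where open ≡-Reasoning

count-monoʳ-≤ : ∀ f {a b} → a ≤ b → count f a ≤ count f b
count-monoʳ-≤ f {a} {b} a≤b = begin
  count f a                                       ≤⟨ m≤m+n _ _ ⟩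
  count f a + count (λ x → f (a + x)) (b ∸ a)     ≡⟨ count-+ f a (b ∸ a) ⟨
  count f (a + (b ∸ a))                           ≡⟨ cong (count f) (m+[n∸m]≡n a≤b) ⟩
  count f b                                       ∎
  where open ≤-Reasoning

count-not : ∀ f n → count f n + count (not ∘ f) n ≡ n
count-not f zero    = refl
count-not f (suc n) = begin
  (bit (f 0) + count (f ∘ suc) n) + (bit (not (f 0)) + count (not ∘ f ∘ suc) n)
    ≡⟨ +-interchange (bit (f 0)) _ _ _ ⟩
  (bit (f 0) + bit (not (f 0))) + (count (f ∘ suc) n + count (not ∘ f ∘ suc) n)
    ≡⟨ cong₂ _+_ (bit-not (f 0)) (count-not (f ∘ suc) n) ⟩
  suc n ∎
  where
  open ≡-Reasoning
  bit-not : ∀ b → bit b + bit (not b) ≡ 1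
  bit-not false = refl
  bit-not true  = refl

count-≡ᵇ : ∀ {c M} → c < M → count (_≡ᵇ c) M ≡ 1
count-≡ᵇ {zero}  {suc M} _         = cong suc (count-none M (λ _ _ → refl))
count-≡ᵇ {suc c} {suc M} (s<s c<M) = count-≡ᵇ c<M

Close : ℕ → ℕ → ℕ → Set
Close ε a b = (a ≤ b + ε) × (b ≤ a + ε)

Close-*ˡ : ∀ c {ε a b} → Close ε a b → Close (c * ε) (c * a) (c * b)
Close-*ˡ c {ε} {a} {b} (a≤b+ε , b≤a+ε) =
  ≤-trans (*-monoʳ-≤ c a≤b+ε) (≤-reflexive (*-distribˡ-+ c b ε)) ,
  ≤-trans (*-monoʳ-≤ c b≤a+ε) (≤-reflexive (*-distribˡ-+ c a ε))

Close-weaken : ∀ {ε ε′ a b} → ε ≤ ε′ → Close ε a b → Close ε′ a b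
Close-weaken {a = a} {b} ε≤ε′ (a≤b+ε , b≤a+ε) =
  ≤-trans a≤b+ε (+-monoʳ-≤ b ε≤ε′) , ≤-trans b≤a+ε (+-monoʳ-≤ a ε≤ε′)

Close-trans : ∀ {ε δ a b c} → Close ε a b → Close δ b c → Close (ε + δ) a c
Close-trans {ε} {δ} {a} {b} {c} (a≤b+ε , b≤a+ε) (b≤c+δ , c≤b+δ) = a≤c+ε+δ , c≤a+ε+δ
  where
  open ≤-Reasoning
  a≤c+ε+δ = begin
    a            ≤⟨ a≤b+ε ⟩
    b + ε        ≤⟨ +-monoˡ-≤ ε b≤c+δ ⟩
    c + δ + ε    ≡⟨ +-assoc c δ ε ⟩
    c + (δ + ε)  ≡⟨ cong (c +_) (+-comm δ ε) ⟩
    c + (ε + δ)  ∎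
  c≤a+ε+δ = begin
    c            ≤⟨ c≤b+δ ⟩
    b + δ        ≤⟨ +-monoˡ-≤ δ b≤a+ε ⟩
    a + ε + δ    ≡⟨ +-assoc a ε δ ⟩
    a + (ε + δ)  ∎

Close-complement : ∀ {ε a b c d} → a + b ≡ c + d → Close ε a c → Close ε b d
Close-complement {ε} {a} {b} {c} {d} a+b≡c+d (a≤c+ε , c≤a+ε) = b≤d+ε , d≤b+ε
  where
  open ≤-Reasoning
  b≤d+ε = +-cancelˡ-≤ a b (d + ε) (begin
    a + b        ≡⟨ a+b≡c+d ⟩
    c + d        ≤⟨ +-monoˡ-≤ d c≤a+ε ⟩
    a + ε + d    ≡⟨ +-assoc a ε d ⟩
    a + (ε + d)  ≡⟨ cong (a +_) (+-comm ε d) ⟩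
    a + (d + ε)  ∎)
  d≤b+ε = +-cancelˡ-≤ c d (b + ε) (begin
    c + d        ≡⟨ a+b≡c+d ⟨
    a + b        ≤⟨ +-monoˡ-≤ b a≤c+ε ⟩
    c + ε + b    ≡⟨ +-assoc c ε b ⟩
    c + (ε + b)  ≡⟨ cong (c +_) (+-comm ε b) ⟩
    c + (b + ε)  ∎)

hasResidue : (M c : ℕ) .{{_ : NonZero M}} → ℕ → Bool
hasResidue M c x = x % M ≡ᵇ c

module Residues (M : ℕ) .{{_ : NonZero M}} {c : ℕ} (c<M : c < M) where

  count-residue-window : ∀ a → count (λ x → hasResidue M c (a + x)) M ≡ 1
  count-residue-window zero    =
    trans (count-cong M (λ x x<M → cong (_≡ᵇ c) (m<n⇒m%n≡m x<M))) (count-≡ᵇ c<M)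
  count-residue-window (suc a) = +-cancelˡ-≡ (bit (f 0)) _ _ (begin
    bit (f 0) + count (λ x → hasResidue M c (suc a + x)) M
      ≡⟨ cong (bit (f 0) +_) (count-cong M (λ x _ → cong (hasResidue M c) (sym (+-suc a x)))) ⟩
    count f (suc M)           ≡⟨ count-suc f M ⟩
    count f M + bit (f M)     ≡⟨ cong₂ _+_ (count-residue-window a) (cong (bit ∘ (_≡ᵇ c)) f-periodic) ⟩
    1 + bit (f 0)             ≡⟨ +-comm 1 _ ⟩
    bit (f 0) + 1             ∎)
    where
    open ≡-Reasoning
    f : ℕ → Bool
    f x = hasResidue M c (a + x)
    f-periodic : (a + M) % M ≡ (a + 0) % M
    f-periodic = trans ([m+n]%n≡m%n a M) (cong (_% M) (sym (+-identityʳ a)))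

  count-residue-periods : ∀ Q ρ → count (hasResidue M c) (Q * M + ρ) ≡ Q + count (hasResidue M c) ρ
  count-residue-periods zero    ρ = refl
  count-residue-periods (suc Q) ρ = begin
    count (hasResidue M c) ((M + Q * M) + ρ)
      ≡⟨ cong (count (hasResidue M c)) (+-assoc M (Q * M) ρ) ⟩
    count (hasResidue M c) (M + (Q * M + ρ))
      ≡⟨ count-+ (hasResidue M c) M _ ⟩
    count (hasResidue M c) M + count (λ x → hasResidue M c (M + x)) (Q * M + ρ)
      ≡⟨ cong₂ _+_ (count-residue-window 0) (count-cong (Q * M + ρ) (λ x _ → cong (_≡ᵇ c) shift)) ⟩
    1 + count (hasResidue M c) (Q * M + ρ)
      ≡⟨ cong suc (count-residue-periods Q ρ) ⟩
    suc Q + count (hasResidue M c) ρ ∎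
    where
    open ≡-Reasoning
    shift : ∀ {x} → (M + x) % M ≡ x % M
    shift {x} = trans (cong (_% M) (+-comm M x)) ([m+n]%n≡m%n x M)

  count-residue-close : ∀ N → Close M (M * count (hasResidue M c) N) N
  count-residue-close N = upper , lower
    where
    open ≤-Reasoning
    Q = N / M
    ρ = N % M
    N≡QM+ρ : N ≡ Q * M + ρ
    N≡QM+ρ = trans (m≡m%n+[m/n]*n N M) (+-comm ρ _)
    count≡ : count (hasResidue M c) N ≡ Q + count (hasResidue M c) ρ
    count≡ = trans (cong (count (hasResidue M c)) N≡QM+ρ) (count-residue-periods Q ρ)
    partial≤1 : count (hasResidue M c) ρ ≤ 1
    partial≤1 = ≤-trans (count-monoʳ-≤ (hasResidue M c) (m%n≤n N M)) (≤-reflexive (count-residue-window 0))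
    upper : M * count (hasResidue M c) N ≤ N + M
    upper = begin
      M * count (hasResidue M c) N          ≡⟨ cong (M *_) count≡ ⟩
      M * (Q + count (hasResidue M c) ρ)    ≡⟨ *-distribˡ-+ M Q _ ⟩
      M * Q + M * count (hasResidue M c) ρ  ≤⟨ +-mono-≤ (≤-reflexive (*-comm M Q)) (*-monoʳ-≤ M partial≤1) ⟩
      Q * M + M * 1                         ≤⟨ +-mono-≤ (m≤m+n (Q * M) ρ) (≤-reflexive (*-identityʳ M)) ⟩
      (Q * M + ρ) + M                       ≡⟨ cong (_+ M) N≡QM+ρ ⟨
      N + M                                 ∎
    lower : N ≤ M * count (hasResidue M c) N + M
    lower = begin
      N                                       ≡⟨ N≡QM+ρ ⟩
      Q * M + ρ                               ≤⟨ +-mono-≤ (≤-reflexive (*-comm Q M)) (m%n≤n N M) ⟩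
      M * Q + M                               ≤⟨ +-monoˡ-≤ M (*-monoʳ-≤ M (m≤m+n Q _)) ⟩
      M * (Q + count (hasResidue M c) ρ) + M  ≡⟨ cong (λ t → M * t + M) count≡ ⟨
      M * count (hasResidue M c) N + M        ∎

count-residue-aligned-window : ∀ {d P c r s} .{{_ : NonZero d}} .{{_ : NonZero P}} →
  d ∣ P → c < d → r ≤ c → d ∣ s → count (λ x → hasResidue P c (s + x)) (P + r) ≡ 1
count-residue-aligned-window {d} {P} {c} {r} {s} d∣P c<d r≤c d∣s = begin
  count F (P + r)                          ≡⟨ count-+ F P r ⟩
  count F P + count (λ x → F (P + x)) r    ≡⟨ cong₂ _+_ (Residues.count-residue-window P c<P s)
                                                          (count-none r beyond) ⟩
  1                                        ∎
  where
  open ≡-Reasoning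
  F : ℕ → Bool
  F x = hasResidue P c (s + x)
  c<P : c < P
  c<P = ≤-trans c<d (∣⇒≤ d∣P)
  beyond : ∀ x → x < r → F (P + x) ≡ false
  beyond x x<r = ¬-not λ eq →
    <⇒≱ x<r (≤-trans r≤c (≤-reflexive (c≡x (≡ᵇ⇒≡ _ c (Equivalence.from T-≡ eq)))))
    where
    c≡x : (s + (P + x)) % P ≡ c → c ≡ x
    c≡x y%P≡c = begin
      c                      ≡⟨ m<n⇒m%n≡m c<d ⟨
      c % d                  ≡⟨ cong (_% d) y%P≡c ⟨
      (s + (P + x)) % P % d  ≡⟨ m∣n⇒o%n%m≡o%m d P (s + (P + x)) d∣P ⟩
      (s + (P + x)) % d      ≡⟨ cong (_% d) (+-assoc s P x) ⟨
      (s + P + x) % d        ≡⟨ %-remove-+ˡ x (∣m∣n⇒∣m+n d∣s d∣P) ⟩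
      x % d                  ≡⟨ m<n⇒m%n≡m (<-≤-trans x<r (≤-trans r≤c (<⇒≤ c<d))) ⟩
      x                      ∎

count-by-rank : ∀ h g L → count (λ x → h x ∧ g (count h x)) L ≡ count g (count h L)
count-by-rank h g zero    = refl
count-by-rank h g (suc L) with h 0 | count-by-rank (h ∘ suc) (λ y → g (bit (h 0) + y)) L
... | true  | eq = cong (bit (g 0) +_) eq
... | false | eq = eq

count-by-rank-window : ∀ h g s L →
  count (λ x → h (s + x) ∧ g (count h (s + x))) L ≡
  count (λ y → g (count h s + y)) (count (λ x → h (s + x)) L)
count-by-rank-window h g s L = +-cancelˡ-≡ (count F s) _ _ (begin
  count F s + count (λ x → F (s + x)) L        ≡⟨ count-+ F s L ⟨
  count F (s + L)                              ≡⟨ count-by-rank h g (s + L) ⟩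
  count g (count h (s + L))                    ≡⟨ cong (count g) (count-+ h s L) ⟩
  count g (count h s + selected)               ≡⟨ count-+ g (count h s) selected ⟩
  count g (count h s) + ranked                 ≡⟨ cong (_+ ranked) (count-by-rank h g s) ⟨
  count F s + ranked                           ∎)
  where
  open ≡-Reasoning
  F : ℕ → Bool
  F x = h x ∧ g (count h x)
  selected = count (λ x → h (s + x)) L
  ranked = count (λ y → g (count h s + y)) selected

≤ᵇ⇔≤ : ∀ {m n} → (m ≤ᵇ n) ≡ true ⇔ m ≤ n
≤ᵇ⇔≤ {m} {n} = mk⇔ (≤ᵇ⇒≤ m n ∘ Equivalence.from T-≡) (Equivalence.to T-≡ ∘ ≤⇒≤ᵇ)

<ᵇ⇔< : ∀ {m n} → (m <ᵇ n) ≡ true ⇔ m < n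
<ᵇ⇔< {m} {n} = mk⇔ (<ᵇ⇒< m n ∘ Equivalence.from T-≡) (Equivalence.to T-≡ ∘ <⇒<ᵇ)

<ᵇ-suc : ∀ m n → (m <ᵇ suc n) ≡ (m ≤ᵇ n)
<ᵇ-suc zero    n = refl
<ᵇ-suc (suc m) n = refl

+-≤ᵇ : ∀ a m n → (a + m ≤ᵇ a + n) ≡ (m ≤ᵇ n)
+-≤ᵇ zero    m n = refl
+-≤ᵇ (suc a) m n = trans (<ᵇ-suc (a + m) (a + n)) (+-≤ᵇ a m n)

count-≤ᵇ : ∀ e k → count (e ≤ᵇ_) k ≡ k ∸ e
count-≤ᵇ zero    k       = count-all k (λ _ _ → refl)
count-≤ᵇ (suc e) zero    = refl
count-≤ᵇ (suc e) (suc k) = trans (count-cong k (λ x _ → <ᵇ-suc e x)) (count-≤ᵇ e k)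

inInterval : ℕ → ℕ → ℕ → Bool
inInterval s k x = (s ≤ᵇ x) ∧ (x <ᵇ s + k)

inInterval⇔ : ∀ {s k x} → inInterval s k x ≡ true ⇔ (s ≤ x × x < s + k)
inInterval⇔ {s} {k} {x} = mk⇔
  (λ eq → let (p , q) = Equivalence.to T-∧ (Equivalence.from T-≡ eq)
          in Equivalence.to ≤ᵇ⇔≤ (Equivalence.to T-≡ p) , Equivalence.to <ᵇ⇔< (Equivalence.to T-≡ q))
  (λ (p , q) → cong₂ _∧_ (Equivalence.from ≤ᵇ⇔≤ p) (Equivalence.from <ᵇ⇔< q))

inInterval-below : ∀ {s k x} → x < s → inInterval s k x ≡ false
inInterval-below {s} {k} x<s =
  ¬-not (λ eq → <⇒≱ x<s (proj₁ (Equivalence.to (inInterval⇔ {s} {k}) eq)))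

inInterval-above : ∀ {s k x} → s + k ≤ x → inInterval s k x ≡ false
inInterval-above {s} {k} s+k≤x =
  ¬-not (λ eq → ≤⇒≯ s+k≤x (proj₂ (Equivalence.to (inInterval⇔ {s} {k}) eq)))

inInterval-inside : ∀ {s k x} → x < k → inInterval s k (s + x) ≡ true
inInterval-inside {s} {k} {x} x<k = Equivalence.from inInterval⇔ (m≤m+n s x , +-monoʳ-< s x<k)

count-∧-inInterval : ∀ (f : ℕ → Bool) {s k n} → s + k ≤ n →
  count (λ x → f x ∧ inInterval s k x) n ≡ count (λ x → f (s + x)) k
count-∧-inInterval f {s} {k} {n} s+k≤n = begin
  count F n
    ≡⟨ cong (count F) n≡s+[k+rest] ⟩
  count F (s + (k + rest))
    ≡⟨ count-+ F s (k + rest) ⟩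
  count F s + count (λ x → F (s + x)) (k + rest)
    ≡⟨ cong (count F s +_) (count-+ (λ x → F (s + x)) k rest) ⟩
  count F s + (count (λ x → F (s + x)) k + count (λ x → F (s + (k + x))) rest)
    ≡⟨ cong₂ _+_ (count-none s before) (cong₂ _+_ (count-cong k within) (count-none rest after)) ⟩
  0 + (count (λ x → f (s + x)) k + 0)
    ≡⟨ +-identityʳ _ ⟩
  count (λ x → f (s + x)) k
    ∎
  where
  open ≡-Reasoning
  F : ℕ → Bool
  F x = f x ∧ inInterval s k x
  rest = n ∸ (s + k)
  n≡s+[k+rest] : n ≡ s + (k + rest)
  n≡s+[k+rest] = trans (sym (m+[n∸m]≡n s+k≤n)) (+-assoc s k rest)
  before : ∀ x → x < s → F x ≡ false
  before x x<s = trans (cong (f x ∧_) (inInterval-below {s} {k} x<s)) (∧-zeroʳ (f x))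
  within : ∀ x → x < k → F (s + x) ≡ f (s + x)
  within x x<k = trans (cong (f (s + x) ∧_) (inInterval-inside {s} {k} x<k)) (∧-identityʳ _)
  after : ∀ x → x < rest → F (s + (k + x)) ≡ false
  after x _ = trans (cong (f (s + (k + x)) ∧_) (inInterval-above {s} {k} s+k≤s+[k+x]))
                    (∧-zeroʳ (f (s + (k + x))))
    where
    s+k≤s+[k+x] : s + k ≤ s + (k + x)
    s+k≤s+[k+x] = ≤-trans (m≤m+n (s + k) x) (≤-reflexive (+-assoc s k x))

record Represents {n} (p : Subset n) (f : ℕ → Bool) : Set where
  constructor represents
  field
    membership : (v : Fin n) → v ∈ p ⇔ f (toℕ v) ≡ true

open Represents

Represents-tail : ∀ {n b} {p : Subset n} {f} → Represents (b ∷ p) f → Represents p (f ∘ suc)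
Represents-tail rep = represents λ v →
  mk⇔ (Equivalence.to (membership rep (Fin.suc v)) ∘ there)
      ((λ { (there v∈p) → v∈p }) ∘ Equivalence.from (membership rep (Fin.suc v)))

∣p∣≡count : ∀ {n} {p : Subset n} {f} → Represents p f → ∣ p ∣ ≡ count f n
∣p∣≡count {zero}  {[]}              _   = refl
∣p∣≡count {suc n} {inside ∷ p}      rep rewrite Equivalence.to (membership rep Fin.zero) here =
  cong suc (∣p∣≡count (Represents-tail rep))
∣p∣≡count {suc n} {outside ∷ p} {f} rep with f 0 in f0
... | true  = contradiction (Equivalence.from (membership rep Fin.zero) f0) λ ()
... | false = ∣p∣≡count (Represents-tail rep)

Represents-∩ : ∀ {n} {p q : Subset n} {f g} →
  Represents p f → Represents q g → Represents (p ∩ q) (λ x → f x ∧ g x)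
Represents-∩ {p = p} {q} repp repq = represents λ v → mk⇔
  (λ v∈p∩q → let (v∈p , v∈q) = x∈p∩q⁻ p q v∈p∩q
             in cong₂ _∧_ (Equivalence.to (membership repp v) v∈p)
                           (Equivalence.to (membership repq v) v∈q))
  (λ eq → let (fv , gv) = Equivalence.to T-∧ (Equivalence.from T-≡ eq)
          in x∈p∩q⁺ (Equivalence.from (membership repp v) (Equivalence.to T-≡ fv) ,
                     Equivalence.from (membership repq v) (Equivalence.to T-≡ gv)))

Represents-tabulate : ∀ {n} f → Represents (tabulate {n = n} (f ∘ toℕ)) f
Represents-tabulate f = represents λ v → mk⇔
  (λ v∈p → trans (sym (lookup∘tabulate (f ∘ toℕ) v)) ([]=⇒lookup v∈p))
  (λ fv → lookup⇒[]= v _ (trans (lookup∘tabulate (f ∘ toℕ) v) fv))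

intervals-overlap : ∀ {n} {p q : Subset n} {a b k e} →
  Represents p (inInterval a k) → Represents q (inInterval b k) → b + k ≤ n → b + e ≡ a →
  ∣ p ∩ q ∣ ≡ k ∸ e
intervals-overlap {n} {p} {q} {a} {b} {k} {e} repp repq b+k≤n refl = begin
  ∣ p ∩ q ∣                                             ≡⟨ ∣p∣≡count (Represents-∩ repp repq) ⟩
  count (λ x → inInterval a k x ∧ inInterval b k x) n  ≡⟨ count-∧-inInterval (inInterval a k) {b} {k} b+k≤n ⟩
  count (λ x → inInterval a k (b + x)) k               ≡⟨ count-cong k shifted ⟩
  count (e ≤ᵇ_) k                                      ≡⟨ count-≤ᵇ e k ⟩
  k ∸ e                                                ∎
  where
  open ≡-Reasoning
  shifted : ∀ x → x < k → inInterval (b + e) k (b + x) ≡ (e ≤ᵇ x)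
  shifted x x<k = trans (cong₂ _∧_ (+-≤ᵇ b e x) (Equivalence.from <ᵇ⇔< b+x<b+e+k)) (∧-identityʳ _)
    where
    b+x<b+e+k : b + x < b + e + k
    b+x<b+e+k = ≤-trans (+-monoʳ-< b (≤-trans x<k (m≤n+m k e))) (≤-reflexive (sym (+-assoc b e k)))

gap-from-overlap : ∀ {n} {p q : Subset n} {a b k ℓ} →
  Represents p (inInterval a k) → Represents q (inInterval b k) → b + k ≤ n →
  ∣ p ∩ q ∣ ≡ ℓ → 1 ≤ ℓ → b ≤ a → a ≡ b + (k ∸ ℓ)
gap-from-overlap {a = a} {b} {k} {ℓ} repp repq b+k≤n ∣p∩q∣≡ℓ 1≤ℓ b≤a =
  trans (sym (m+[n∸m]≡n b≤a)) (cong (b +_) (sym k∸ℓ≡gap))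
  where
  ℓ≡k∸gap : ℓ ≡ k ∸ (a ∸ b)
  ℓ≡k∸gap = trans (sym ∣p∩q∣≡ℓ) (intervals-overlap repp repq b+k≤n (m+[n∸m]≡n b≤a))
  gap≤k : a ∸ b ≤ k
  gap≤k = ≮⇒≥ (λ k<gap → <⇒≱ 1≤ℓ (≤-reflexive (trans ℓ≡k∸gap (m≤n⇒m∸n≡0 (<⇒≤ k<gap)))))
  k∸ℓ≡gap : k ∸ ℓ ≡ a ∸ b
  k∸ℓ≡gap = trans (cong (k ∸_) ℓ≡k∸gap) (m∸[m∸n]≡n gap≤k)

intervals-gap : ∀ {n} {p q : Subset n} {a b k ℓ} →
  Represents p (inInterval a k) → Represents q (inInterval b k) → a + k ≤ n → b + k ≤ n →
  ∣ p ∩ q ∣ ≡ ℓ → 1 ≤ ℓ → a ≡ b + (k ∸ ℓ) ⊎ b ≡ a + (k ∸ ℓ)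
intervals-gap {p = p} {q} {a} {b} repp repq a+k≤n b+k≤n ∣p∩q∣≡ℓ 1≤ℓ with ≤-total b a
... | inj₁ b≤a = inj₁ (gap-from-overlap repp repq b+k≤n ∣p∩q∣≡ℓ 1≤ℓ b≤a)
... | inj₂ a≤b = inj₂ (gap-from-overlap repq repp a+k≤n ∣q∩p∣≡ℓ 1≤ℓ a≤b)
  where
  ∣q∩p∣≡ℓ = trans (cong ∣_∣ (∩-comm q p)) ∣p∩q∣≡ℓ

module Colouring (P : ℕ) .{{_ : NonZero P}} {c : ℕ} (c<P : c < P) (K : ℕ) .{{_ : NonZero K}} where

  marked : ℕ → Bool
  marked = hasResidue P c

  rank : ℕ → ℕ
  rank = count (not ∘ marked)

  colour : Fin (suc K) → ℕ → Bool
  colour Fin.zero    x = marked x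
  colour (Fin.suc i) x = not (marked x) ∧ hasResidue K (toℕ i) (rank x)

  colour-exists : ∀ x → ∃ λ i → colour i x ≡ true
  colour-exists x with marked x in eq
  ... | true  = Fin.zero , eq
  ... | false = Fin.suc i , trans (cong (λ b → not b ∧ hasResidue K (toℕ i) (rank x)) eq)
                                  (Equivalence.to T-≡ (≡⇒≡ᵇ _ _ (sym (toℕ-fromℕ< (m%n<n (rank x) K)))))
    where
    i = Fin.fromℕ< (m%n<n (rank x) K)

  rank-residue : ∀ {x} i → colour (Fin.suc i) x ≡ true → rank x % K ≡ toℕ i
  rank-residue {x} i eq = ≡ᵇ⇒≡ _ _ (proj₂ (Equivalence.to T-∧ (Equivalence.from T-≡ eq)))

  colour-unique : ∀ x i j → colour i x ≡ true → colour j x ≡ true → i ≡ j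
  colour-unique x Fin.zero    Fin.zero    _   _   = refl
  colour-unique x Fin.zero    (Fin.suc j) eqᵢ eqⱼ rewrite eqᵢ = contradiction eqⱼ λ ()
  colour-unique x (Fin.suc i) Fin.zero    eqᵢ eqⱼ rewrite eqⱼ = contradiction eqᵢ λ ()
  colour-unique x (Fin.suc i) (Fin.suc j) eqᵢ eqⱼ =
    cong Fin.suc (toℕ-injective (trans (sym (rank-residue i eqᵢ)) (rank-residue j eqⱼ)))

  count-colour-window : ∀ s → count (λ x → marked (s + x)) (suc K) ≡ 1 →
    ∀ i → count (λ x → colour i (s + x)) (suc K) ≡ 1
  count-colour-window s one-marked Fin.zero    = one-marked
  count-colour-window s one-marked (Fin.suc i) = begin
    count (λ x → colour (Fin.suc i) (s + x)) (suc K)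
      ≡⟨ count-by-rank-window (not ∘ marked) (hasResidue K (toℕ i)) s (suc K) ⟩
    count (λ y → hasResidue K (toℕ i) (rank s + y)) (count (λ x → not (marked (s + x))) (suc K))
      ≡⟨ cong (count (λ y → hasResidue K (toℕ i) (rank s + y))) K-unmarked ⟩
    count (λ y → hasResidue K (toℕ i) (rank s + y)) K
      ≡⟨ Residues.count-residue-window K (toℕ<n i) (rank s) ⟩
    1 ∎
    where
    open ≡-Reasoning
    K-unmarked : count (λ x → not (marked (s + x))) (suc K) ≡ K
    K-unmarked = suc-injective (begin
      1 + count (λ x → not (marked (s + x))) (suc K)
        ≡⟨ cong (_+ count (λ x → not (marked (s + x))) (suc K)) one-marked ⟨
      count (λ x → marked (s + x)) (suc K) + count (λ x → not (marked (s + x))) (suc K)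
        ≡⟨ count-not (λ x → marked (s + x)) (suc K) ⟩
      suc K ∎)

  weight : Fin (suc K) → ℕ
  weight Fin.zero    = K
  weight (Fin.suc _) = P ∸ 1

  count-colour-close : ∀ n i → Close (2 * (K * P)) ((K * P) * count (colour i) n) (weight i * n)
  count-colour-close n Fin.zero =
    Close-weaken (m≤m+n (K * P) _)
      (subst (λ t → Close (K * P) t (K * n)) (sym (*-assoc K P _))
        (Close-*ˡ K marked-close))
    where
    marked-close : Close P (P * count marked n) n
    marked-close = Residues.count-residue-close P c<P n
  count-colour-close n (Fin.suc i) =
    Close-weaken P*K+P≤2*[K*P]
      (subst (λ t → Close (P * K + P) t ((P ∸ 1) * n)) reassociate
        (Close-trans (Close-*ˡ P coloured-close) unmarked-close))
    where
    N = rank n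
    cᵢ = count (colour (Fin.suc i)) n
    coloured-close : Close K (K * cᵢ) N
    coloured-close = subst (λ t → Close K (K * t) N)
                       (sym (count-by-rank (not ∘ marked) (hasResidue K (toℕ i)) n))
                       (Residues.count-residue-close K (toℕ<n i) N)
    P*n-split : P * count marked n + P * N ≡ n + (P ∸ 1) * n
    P*n-split = begin
      P * count marked n + P * N  ≡⟨ *-distribˡ-+ P _ N ⟨
      P * (count marked n + N)    ≡⟨ cong (P *_) (count-not marked n) ⟩
      P * n                       ≡⟨ cong (_* n) (m+[n∸m]≡n (>-nonZero⁻¹ P)) ⟨
      (1 + (P ∸ 1)) * n           ∎
      where open ≡-Reasoning
    unmarked-close : Close P (P * N) ((P ∸ 1) * n)
    unmarked-close = Close-complement P*n-split (Residues.count-residue-close P c<P n)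
    reassociate : P * (K * cᵢ) ≡ (K * P) * cᵢ
    reassociate = trans (sym (*-assoc P K cᵢ)) (cong (_* cᵢ) (*-comm P K))
    P*K+P≤2*[K*P] : P * K + P ≤ 2 * (K * P)
    P*K+P≤2*[K*P] = +-mono-≤ (≤-reflexive (*-comm P K)) (≤-trans (m≤n*m P K) (m≤m+n _ 0))

module ℓPath {k ℓ n m} {E : Fin m → Subset n} (path : IsLPath k ℓ n m E) where

  open IsLPath path

  start : Fin m → ℕ
  start j = proj₁ (consecutive j)

  start+k≤n : ∀ j → start j + k ≤ n
  start+k≤n j = proj₁ (proj₂ (consecutive j))

  edge-interval : ∀ j → Represents (E j) (inInterval (start j) k)
  edge-interval j = represents λ v → ⇔-trans (proj₂ (proj₂ (consecutive j)) v) (⇔-sym inInterval⇔)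

  module _ (1≤ℓ : 1 ≤ ℓ) .{{_ : NonZero (k ∸ ℓ)}} where

    private
      d = k ∸ ℓ

    adjacent-starts-≡ : ∀ j (p : suc j < m) →
      start (Fin.fromℕ< (<-trans (n<1+n j) p)) % d ≡ start (Fin.fromℕ< p) % d
    adjacent-starts-≡ j p
      with intervals-gap (edge-interval _) (edge-interval _) (start+k≤n _) (start+k≤n _) (overlapℓ j p) 1≤ℓ
    ... | inj₁ a≡b+d = trans (cong (_% d) a≡b+d) ([m+n]%n≡m%n _ d)
    ... | inj₂ b≡a+d = sym (trans (cong (_% d) b≡a+d) ([m+n]%n≡m%n _ d))

    starts-≡-first : ∀ j (p : j < m) (q : 0 < m) → start (Fin.fromℕ< p) % d ≡ start (Fin.fromℕ< q) % d
    starts-≡-first zero    p q = cong (λ i → start i % d) (fromℕ<-cong 0 0 refl p q)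
    starts-≡-first (suc j) p q = trans (sym (adjacent-starts-≡ j p)) (starts-≡-first j (<-trans (n<1+n j) p) q)

    starts-≡ : ∀ i j → start i % d ≡ start j % d
    starts-≡ i j = trans (from-toℕ i) (sym (from-toℕ j))
      where
      0<m = <-≤-trans z<s (toℕ<n i)
      from-toℕ : ∀ i → start i % d ≡ start (Fin.fromℕ< 0<m) % d
      from-toℕ i = trans (cong (λ i → start i % d) (sym (fromℕ<-toℕ i (toℕ<n i))))
                         (starts-≡-first (toℕ i) (toℕ<n i) 0<m)

    starts-aligned : ∀ j → d ∣ start j
    starts-aligned j = m%n≡0⇒n∣m (start j) d
      (trans (starts-≡ j j₀) (trans (cong (_% d) start₀≡0) (m<n⇒m%n≡m (>-nonZero⁻¹ d))))
      where
      0<n : 0 < n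
      0<n = <-≤-trans (<-≤-trans (>-nonZero⁻¹ d) (m∸n≤m k ℓ)) (≤-trans (m≤n+m k (start j)) (start+k≤n j))
      v₀ = Fin.fromℕ< 0<n
      j₀ = proj₁ (noIsolated v₀)
      start₀≡0 : start j₀ ≡ 0
      start₀≡0 = n≤0⇒n≡0 (subst (start j₀ ≤_) (toℕ-fromℕ< 0<n)
                   (proj₁ (Equivalence.to (proj₂ (proj₂ (consecutive j₀)) v₀) (proj₂ (noIsolated v₀)))))

ΣFin-const : ∀ n c → ΣFin n (λ _ → c) ≡ n * c
ΣFin-const zero    c = refl
ΣFin-const (suc n) c = cong (c +_) (ΣFin-const n c)

wRest≡ : ∀ k d .{{_ : NonZero d}} → wRest k d ≡ k / d * d ∸ 1
wRest≡ k (suc d) = refl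

module Construction (K ℓ : ℕ) .{{_ : NonZero K}} (ℓ≤K : ℓ ≤ K) (n : ℕ) where

  d = suc K ∸ ℓ

  instance
    d-nonZero : NonZero d
    d-nonZero = >-nonZero (m<n⇒0<n∸m (s≤s ℓ≤K))

  P = suc K / d * d

  d∣P : d ∣ P
  d∣P = n∣m*n (suc K / d)

  instance
    P-nonZero : NonZero P
    P-nonZero = >-nonZero (*-mono-≤ (m≥n⇒m/n>0 (m∸n≤m (suc K) ℓ)) (>-nonZero⁻¹ d))

  pred[d]<d : pred d < d
  pred[d]<d = ≤-reflexive (suc-pred d)

  open Colouring P (<-≤-trans pred[d]<d (∣⇒≤ d∣P)) K

  U : Fin (suc K) → Subset n
  U i = tabulate (colour i ∘ toℕ)

  U-colour : ∀ i → Represents (U i) (colour i)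
  U-colour i = Represents-tabulate (colour i)

  U-partition : ∀ v → (∃ λ i → v ∈ U i) × (∀ i i′ → v ∈ U i → v ∈ U i′ → i ≡ i′)
  U-partition v = let (i , coloured) = colour-exists (toℕ v) in
    (i , Equivalence.from (membership (U-colour i) v) coloured) ,
    λ i i′ v∈Uᵢ v∈Uᵢ′ → colour-unique (toℕ v) i i′
                          (Equivalence.to (membership (U-colour i) v) v∈Uᵢ)
                          (Equivalence.to (membership (U-colour i′) v) v∈Uᵢ′)

  U∩E≡1 : ∀ {m} {E : Fin m → Subset n} → IsLPath (suc K) ℓ n m E → 1 ≤ ℓ → ∀ i j → ∣ U i ∩ E j ∣ ≡ 1
  U∩E≡1 {E = E} path 1≤ℓ i j = begin
    ∣ U i ∩ E j ∣
      ≡⟨ ∣p∣≡count (Represents-∩ (U-colour i) (edge-interval j)) ⟩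
    count (λ x → colour i x ∧ inInterval (start j) (suc K) x) n
      ≡⟨ count-∧-inInterval (colour i) (start+k≤n j) ⟩
    count (λ x → colour i (start j + x)) (suc K)
      ≡⟨ count-colour-window (start j) one-marked i ⟩
    1 ∎
    where
    open ≡-Reasoning
    open ℓPath path
    k≡P+k%d : suc K ≡ P + suc K % d
    k≡P+k%d = trans (m≡m%n+[m/n]*n (suc K) d) (+-comm (suc K % d) P)
    one-marked : count (λ x → marked (start j + x)) (suc K) ≡ 1
    one-marked = trans (cong (count (λ x → marked (start j + x))) k≡P+k%d)
                   (count-residue-aligned-window d∣P pred[d]<d (<⇒≤pred (m%n<n (suc K) d))
                                                 (starts-aligned 1≤ℓ j))

  Wsum≡K*P : Wsum (suc K) ℓ ≡ K * P
  Wsum≡K*P = begin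
    K + ΣFin K (λ _ → wRest (suc K) d)   ≡⟨ cong (K +_) (ΣFin-const K _) ⟩
    K + K * wRest (suc K) d              ≡⟨ cong (λ t → K + K * t) (wRest≡ (suc K) d) ⟩
    K + K * (P ∸ 1)                      ≡⟨ *-suc K (P ∸ 1) ⟨
    K * (1 + (P ∸ 1))                    ≡⟨ cong (K *_) (m+[n∸m]≡n (>-nonZero⁻¹ P)) ⟩
    K * P                                ∎
    where open ≡-Reasoning

  w≡weight : ∀ i → w (suc K) ℓ i ≡ weight i
  w≡weight Fin.zero    = refl
  w≡weight (Fin.suc i) = wRest≡ (suc K) d

  ∣U∣-close : ∀ i → Close (2 * Wsum (suc K) ℓ) (Wsum (suc K) ℓ * ∣ U i ∣) (w (suc K) ℓ i * n)
  ∣U∣-close i rewrite Wsum≡K*P | w≡weight i | ∣p∣≡count (U-colour i) = count-colour-close n i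

proposition1p6 : (k ℓ n m : ℕ) → 3 ≤ k → 1 ≤ ℓ → ℓ ≤ k ∸ 1 →
    (E : Fin m → Subset n) → IsLPath k ℓ n m E →
    Σ (Fin k → Subset n) λ U →
      ((v : Fin n) → (∃ λ i → v ∈ U i) × ((i i′ : Fin k) → v ∈ U i → v ∈ U i′ → i ≡ i′))
      × ((i : Fin k) (j : Fin m) → ∣ U i ∩ E j ∣ ≡ 1)
      × ((i : Fin k) → (Wsum k ℓ * ∣ U i ∣ ≤ w k ℓ i * n + 2 * Wsum k ℓ)
                     × (w k ℓ i * n ≤ Wsum k ℓ * ∣ U i ∣ + 2 * Wsum k ℓ))
proposition1p6 (suc K) ℓ n m (s≤s 2≤K) 1≤ℓ ℓ≤K E path = U , U-partition , U∩E≡1 path 1≤ℓ , ∣U∣-close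
  where
  instance
    K-nonZero : NonZero K
    K-nonZero = >-nonZero (<-≤-trans z<s 2≤K)
  open Construction K ℓ ℓ≤K n
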